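{- A connected graph $F$ has the property that every 4-connected $F$-free graph has an $H^2$ if and only if $F=P_3$.
   Context: All graphs are finite and simple. $P_3$ is the path on 3 vertices. A graph is $F$-free if it has no induced subgraph isomorphic to $F$. The square of a graph is obtained by adding edges joining all pairs of vertices at distance two. A graph $G$ has an $H^2$ if $G$ contains, as a subgraph, the square of some hamiltonian cycle of $G$. -}

module Defs where

open import Data.Nat using (ℕ; zero; suc; _+_; _≤_; _<_)
open import Data.Fin using (Fin; toℕ) renaming (zero to f0; suc to fs)
open import Data.Fin.Subset using (Subset; _∈_; _∉_; ∣_∣)
open import Data.Bool using (Bool; true; false)
open import Data.Product using (Σ; _×_; _,_)
open import Data.Sum using (_⊎_)
open import Data.Unit using (⊤)
open import Function.Bundles using (_↣_; _↔_; Injection; Inverse)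
open import Relation.Binary.PropositionalEquality using (_≡_; refl)
open import Data.Empty using (⊥)

record Graph : Set where
  field
    size   : ℕ
    adj    : Fin size → Fin size → Bool
    adj-sym    : ∀ u v → adj u v ≡ adj v u
    adj-irrefl : ∀ v → adj v v ≡ false

open Graph public

Edge : (G : Graph) → Fin (size G) → Fin (size G) → Set
Edge G u v = adj G u v ≡ true

data Walk (G : Graph) (P : Fin (size G) → Set) : Fin (size G) → Fin (size G) → Set where
  stop : ∀ {u} → P u → Walk G P u u
  step : ∀ {u w v} → P u → Edge G u w → Walk G P w v → Walk G P u v

Connected : Graph → Set
Connected G = (1 ≤ size G) × (∀ u v → Walk G (λ _ → ⊤) u v)

KConnected : ℕ → Graph → Set
KConnected k G =
  (k < size G) ×
  (∀ (S : Subset (size G)) → ∣ S ∣ < k →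
     ∀ u v → u ∉ S → v ∉ S → Walk G (λ w → w ∉ S) u v)

InducedSub : Graph → Graph → Set
InducedSub F G =
  Σ (Fin (size F) ↣ Fin (size G)) λ f →
    ∀ u v → adj G (Injection.to f u) (Injection.to f v) ≡ adj F u v

Free : Graph → Graph → Set
Free F G = InducedSub F G → ⊥

_≅_ : Graph → Graph → Set
F ≅ H = Σ (Fin (size F) ↔ Fin (size H)) λ f →
    ∀ u v → adj H (Inverse.to f u) (Inverse.to f v) ≡ adj F u v

p3adj : Fin 3 → Fin 3 → Bool
p3adj f0 (fs f0) = true
p3adj (fs f0) f0 = true
p3adj (fs f0) (fs (fs f0)) = true
p3adj (fs (fs f0)) (fs f0) = true
p3adj _ _ = false

private
  p3sym : ∀ u v → p3adj u v ≡ p3adj v u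
  p3sym f0 f0 = refl
  p3sym f0 (fs f0) = refl
  p3sym f0 (fs (fs f0)) = refl
  p3sym (fs f0) f0 = refl
  p3sym (fs f0) (fs f0) = refl
  p3sym (fs f0) (fs (fs f0)) = refl
  p3sym (fs (fs f0)) f0 = refl
  p3sym (fs (fs f0)) (fs f0) = refl
  p3sym (fs (fs f0)) (fs (fs f0)) = refl

  p3irr : ∀ v → p3adj v v ≡ false
  p3irr f0 = refl
  p3irr (fs f0) = refl
  p3irr (fs (fs f0)) = refl

P₃ : Graph
P₃ = record { size = 3 ; adj = p3adj ; adj-sym = p3sym ; adj-irrefl = p3irr }

-- j is k steps after i along the cyclic order 0,1,...,n-1,0 (indices mod n).
CycAfter : ∀ {n} → ℕ → Fin n → Fin n → Set
CycAfter {n} k i j = (toℕ j ≡ toℕ i + k) ⊎ (toℕ j + n ≡ toℕ i + k)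

-- G has an H²: there is a hamiltonian cycle σ(0),σ(1),...,σ(n-1) of G
-- (n ≥ 3) such that G contains the square of this cycle, i.e. every pair
-- of vertices at cycle-distance 1 or 2 is adjacent in G.
HasH² : Graph → Set
HasH² G =
  (3 ≤ size G) ×
  Σ (Fin (size G) ↔ Fin (size G)) λ σ →
    ∀ i j → (CycAfter 1 i j ⊎ CycAfter 2 i j) →
      Edge G (Inverse.to σ i) (Inverse.to σ j)

module Submission where

-- Sufficiency: in a P₃-free graph the ends of every walk are equal or adjacent, so a
-- connected P₃-free graph is complete, and a complete graph on n ≥ 3 vertices contains
-- the square of any hamiltonian cycle (the identity ordering).
--
-- Necessity: three 4-connected graphs without an H² must all contain F as an induced
-- subgraph: K₄,₄ (an H² contains a triangle), G₂ = C₅ ∨ 2K₁ and G₃ = K₄ ∨ 3K₁ (nonadjacent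
-- vertices of a graph with an H² sit at cycle distance ≥ 3, and on the 7-cycle there is
-- no closed 3- or 5-walk of such steps).  Their 4-connectivity is certified by
-- internally disjoint routes (Menger's easy direction).  Being induced in K₄,₄, F is
-- complete bipartite; G₂ is claw-free and G₃ is C₄-free, so F has at most three vertices,
-- and a connected triangle-free graph on three vertices is P₃.

open import Defs
open import Data.Bool using (Bool; true; false; not; _∧_; _∨_; _xor_)
import Data.Bool.Properties as Bool
open import Data.Empty using (⊥; ⊥-elim)
open import Data.Fin using (Fin; toℕ; inject≤; #_) renaming (zero to f0; suc to fs)
open import Data.Fin.Properties using (_≟_; all?; inject≤-injective)
open import Data.Fin.Permutation using (transpose)
open import Data.Fin.Subset using (Subset; ∣_∣; _-_) renaming (_∈_ to _∈ₛ_; _∉_ to _∉ₛ_; ⊥ to ∅)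
open import Data.Fin.Subset.Properties using (x∈p∧x≢y⇒x∈p-y; x∈p⇒∣p-x∣<∣p∣; ∉⊥; ∣⊥∣≡0)
  renaming (_∈?_ to _∈ₛ?_)
open import Data.List using (List; []; _∷_; length; _++_; map; concatMap; filter; allFin)
open import Data.List.Relation.Unary.All as All using (All; []; _∷_)
open import Data.List.Relation.Unary.All.Properties using (¬Any⇒All¬)
open import Data.List.Relation.Unary.Any using (Any; any?)
open import Data.List.Relation.Unary.AllPairs using (AllPairs; []; _∷_; allPairs?)
open import Data.List.Membership.Propositional using (_∉_; find; lose)
open import Data.Nat using (ℕ; suc; _+_; _≤_; _<_; _<ᵇ_; _≤ᵇ_; z≤n; s≤s)
import Data.Nat.Properties as ℕ
open import Data.Product using (∃-syntax; _×_; _,_; proj₁; proj₂)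
open import Data.Sum using (_⊎_; inj₁; inj₂; [_,_])
open import Function using (_∘_; case_of_)
open import Function.Bundles using (_↣_; _↔_; _⇔_; Injection; Inverse; mk↣; mk↔ₛ′; mk⇔)
open import Relation.Nullary using (¬_; Dec; yes; no)
open import Relation.Nullary.Decidable using (True; ⌊_⌋; toWitness; ¬?; _×-dec_; _⊎-dec_; _→-dec_)
open import Relation.Binary.PropositionalEquality using (_≡_; _≢_; refl; sym; trans; cong; cong₂; subst)

Vertex : Graph → Set
Vertex G = Fin (size G)

edge? : (G : Graph) (u v : Vertex G) → Dec (Edge G u v)
edge? G u v = adj G u v Bool.≟ true

non-edge? : (G : Graph) (u v : Vertex G) → Dec (adj G u v ≡ false)
non-edge? G u v = adj G u v Bool.≟ false

distinct? : ∀ {n} (u v : Fin n) → Dec (u ≢ v)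
distinct? u v = ¬? (u ≟ v)

neighbour : ∀ {G} → Connected G → ∀ {u v} → u ≢ v → ∃[ w ] Edge G u w
neighbour conn {u} {v} u≢v with proj₂ conn u v
... | stop _ = ⊥-elim (u≢v refl)
... | step _ e _ = _ , e

module Embedding (F G : Graph) (e : InducedSub F G) where
  f : Vertex F → Vertex G
  f = Injection.to (proj₁ e)

  edge : ∀ {u v} → Edge F u v → Edge G (f u) (f v)
  edge {u} {v} uv = trans (proj₂ e u v) uv

  non-edge : ∀ {u v} → adj F u v ≡ false → adj G (f u) (f v) ≡ false
  non-edge {u} {v} uv = trans (proj₂ e u v) uv

  distinct : ∀ {u v} → u ≢ v → f u ≢ f v
  distinct u≢v = u≢v ∘ Injection.injective (proj₁ e)

≅-induced : ∀ {F H G} → F ≅ H → InducedSub H G → InducedSub F G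
≅-induced (φ , φ-adj) (e , e-adj) =
  mk↣ {to = Injection.to e ∘ Inverse.to φ} injective , λ u v → trans (e-adj _ _) (φ-adj u v)
  where
  injective : ∀ {x y} → Injection.to e (Inverse.to φ x) ≡ Injection.to e (Inverse.to φ y) → x ≡ y
  injective {x} {y} eq = trans (sym (Inverse.strictlyInverseʳ φ x))
    (trans (cong (Inverse.from φ) (Injection.injective e eq)) (Inverse.strictlyInverseʳ φ y))

adjacent⇒distinct : ∀ G {x y} → Edge G x y → x ≢ y
adjacent⇒distinct G {x} xy refl with trans (sym xy) (adj-irrefl G x)
... | ()

induced-P₃ : ∀ {G u w v} → Edge G u w → Edge G w v → u ≢ v → adj G u v ≡ false → InducedSub P₃ G
induced-P₃ {G} {u} {w} {v} uw wv u≢v ¬uv = mk↣ {to = path} injective , preserves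
  where
  path : Fin 3 → Vertex G
  path f0           = u
  path (fs f0)      = w
  path (fs (fs f0)) = v

  injective : ∀ {i j} → path i ≡ path j → i ≡ j
  injective {f0}           {f0}           _ = refl
  injective {fs f0}        {fs f0}        _ = refl
  injective {fs (fs f0)}   {fs (fs f0)}   _ = refl
  injective {f0}           {fs f0}        e = ⊥-elim (adjacent⇒distinct G uw e)
  injective {fs f0}        {f0}           e = ⊥-elim (adjacent⇒distinct G uw (sym e))
  injective {fs f0}        {fs (fs f0)}   e = ⊥-elim (adjacent⇒distinct G wv e)
  injective {fs (fs f0)}   {fs f0}        e = ⊥-elim (adjacent⇒distinct G wv (sym e))
  injective {f0}           {fs (fs f0)}   e = ⊥-elim (u≢v e)
  injective {fs (fs f0)}   {f0}           e = ⊥-elim (u≢v (sym e))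

  preserves : ∀ i j → adj G (path i) (path j) ≡ adj P₃ i j
  preserves f0           f0           = adj-irrefl G u
  preserves (fs f0)      (fs f0)      = adj-irrefl G w
  preserves (fs (fs f0)) (fs (fs f0)) = adj-irrefl G v
  preserves f0           (fs f0)      = uw
  preserves (fs f0)      f0           = trans (adj-sym G w u) uw
  preserves (fs f0)      (fs (fs f0)) = wv
  preserves (fs (fs f0)) (fs f0)      = trans (adj-sym G v w) wv
  preserves f0           (fs (fs f0)) = ¬uv
  preserves (fs (fs f0)) f0           = trans (adj-sym G v u) ¬uv

walk⇒adjacent : ∀ {G P u v} → Free P₃ G → Walk G P u v → u ≡ v ⊎ Edge G u v
walk⇒adjacent free (stop _) = inj₁ refl
walk⇒adjacent {G} free (step {u} {w} {v} _ uw rest) with walk⇒adjacent free rest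
... | inj₁ refl = inj₂ uw
... | inj₂ wv with u ≟ v | adj G u v in uv
...   | yes u≡v | _     = inj₁ u≡v
...   | no  _   | true  = inj₂ refl
...   | no  u≢v | false = ⊥-elim (free (induced-P₃ {G} uw wv u≢v uv))

cycle-step-distinct : ∀ {n} {i j : Fin n} → 3 ≤ n → CycAfter 1 i j ⊎ CycAfter 2 i j → i ≢ j
cycle-step-distinct {i = i} _ (inj₁ (inj₁ j≡i+1)) refl = ℕ.m+1+n≢m (toℕ i) (sym j≡i+1)
cycle-step-distinct {i = i} _ (inj₂ (inj₁ j≡i+2)) refl = ℕ.m+1+n≢m (toℕ i) (sym j≡i+2)
cycle-step-distinct {i = i} (s≤s (s≤s (s≤s _))) (inj₁ (inj₂ wrap)) refl with ℕ.+-cancelˡ-≡ (toℕ i) _ _ wrap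
... | ()
cycle-step-distinct {i = i} (s≤s (s≤s (s≤s _))) (inj₂ (inj₂ wrap)) refl with ℕ.+-cancelˡ-≡ (toℕ i) _ _ wrap
... | ()

complete⇒H² : ∀ G → 3 ≤ size G → (∀ u v → u ≢ v → Edge G u v) → HasH² G
complete⇒H² G big complete =
  big , mk↔ₛ′ (λ x → x) (λ x → x) (λ _ → refl) (λ _ → refl) ,
  λ i j step → complete i j (cycle-step-distinct big step)

P₃-sufficient : ∀ F → F ≅ P₃ → ∀ G → KConnected 4 G → Free F G → HasH² G
P₃-sufficient F F≅P₃ G (big , connected) F-free = complete⇒H² G (ℕ.≤-trans (ℕ.n≤1+n 3) (ℕ.<⇒≤ big)) complete
  where
  -- deleting no vertex at all leaves G connected
  no-deletion : ∣ ∅ {size G} ∣ < 4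
  no-deletion = subst (_< 4) (sym (∣⊥∣≡0 (size G))) (s≤s z≤n)

  complete : ∀ u v → u ≢ v → Edge G u v
  complete u v u≢v with walk⇒adjacent (F-free ∘ ≅-induced {F} {P₃} {G} F≅P₃) (connected ∅ no-deletion u v ∉⊥ ∉⊥)
  ... | inj₁ u≡v = ⊥-elim (u≢v u≡v)
  ... | inj₂ uv  = uv

-- Route G u v r: r lists the inner vertices of a walk from u to v in G.
Route : (G : Graph) → Vertex G → Vertex G → List (Vertex G) → Set
Route G u v []      = Edge G u v
Route G u v (x ∷ r) = Edge G u x × Route G x v r

route? : (G : Graph) (u v : Vertex G) (r : List (Vertex G)) → Dec (Route G u v r)
route? G u v []      = edge? G u v
route? G u v (x ∷ r) = edge? G u x ×-dec route? G x v r

route-walk : ∀ {G S u v} r → Route G u v r → u ∉ₛ S → v ∉ₛ S → All (_∉ₛ S) r → Walk G (_∉ₛ S) u v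
route-walk []      uv       u∉ v∉ []         = step u∉ uv (stop v∉)
route-walk (x ∷ r) (ux , xv) u∉ v∉ (x∉ ∷ r∉) = step u∉ ux (route-walk r xv x∉ v∉ r∉)

Disjoint : ∀ {n} → List (Fin n) → List (Fin n) → Set
Disjoint r r′ = All (_∉ r′) r

disjoint? : ∀ {n} (r r′ : List (Fin n)) → Dec (Disjoint r r′)
disjoint? r r′ = All.all? (λ x → ¬? (any? (x ≟_) r′)) r

hitting-bound : ∀ {n} (S : Subset n) rs → AllPairs Disjoint rs → All (Any (_∈ₛ S)) rs → length rs ≤ ∣ S ∣
hitting-bound S []       _                  _            = z≤n
hitting-bound S (r ∷ rs) (r-disj ∷ rs-disj) (hit ∷ hits) with find hit
... | p , p∈r , p∈S =
  ℕ.≤-trans (s≤s (hitting-bound (S - p) rs rs-disj (All.zipWith still-hit (r-disj , hits))))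
            (x∈p⇒∣p-x∣<∣p∣ p∈S)
  where
  still-hit : ∀ {r′} → Disjoint r r′ × Any (_∈ₛ S) r′ → Any (_∈ₛ S - p) r′
  still-hit (r∩r′=∅ , hit′) with find hit′
  ... | q , q∈r′ , q∈S = lose q∈r′ (x∈p∧x≢y⇒x∈p-y q∈S λ { refl → All.lookup r∩r′=∅ p∈r q∈r′ })

avoid-or-meet : ∀ {G} S {u v} → u ∉ₛ S → v ∉ₛ S → ∀ rs → All (Route G u v) rs →
  Walk G (_∉ₛ S) u v ⊎ All (Any (_∈ₛ S)) rs
avoid-or-meet S u∉ v∉ []       []         = inj₂ []
avoid-or-meet S u∉ v∉ (r ∷ rs) (ok ∷ oks) with any? (_∈ₛ? S) r | avoid-or-meet S u∉ v∉ rs oks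
... | no miss | _         = inj₁ (route-walk r ok u∉ v∉ (¬Any⇒All¬ r miss))
... | yes _   | inj₁ walk = inj₁ walk
... | yes hit | inj₂ hits = inj₂ (hit ∷ hits)

DisjointRoutes : ℕ → (G : Graph) → Vertex G → Vertex G → List (List (Vertex G)) → Set
DisjointRoutes k G u v rs = All (Route G u v) rs × AllPairs Disjoint rs × k ≤ length rs

Certificate : ℕ → (G : Graph) → (Vertex G → Vertex G → List (List (Vertex G))) → Set
Certificate k G routes = ∀ u v → u ≡ v ⊎ Edge G u v ⊎ DisjointRoutes k G u v (routes u v)

certificate? : ∀ k G routes → Dec (Certificate k G routes)
certificate? k G routes = all? λ u → all? λ v →
  u ≟ v ⊎-dec edge? G u v ⊎-dec
  (All.all? (route? G u v) (routes u v) ×-dec allPairs? disjoint? (routes u v) ×-dec k ℕ.≤? length (routes u v))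

-- Menger's theorem, easy direction: a certificate for k makes G k-connected.
certificate⇒connected : ∀ k G routes → k < size G → Certificate k G routes → KConnected k G
certificate⇒connected k G routes big cert = big , connect
  where
  connect : ∀ S → ∣ S ∣ < k → ∀ u v → u ∉ₛ S → v ∉ₛ S → Walk G (_∉ₛ S) u v
  connect S small u v u∉ v∉ with cert u v
  ... | inj₁ refl        = stop u∉
  ... | inj₂ (inj₁ uv)   = step u∉ uv (stop v∉)
  ... | inj₂ (inj₂ (valid , disjoint , enough)) with avoid-or-meet S u∉ v∉ (routes u v) valid
  ...   | inj₁ walk = walk
  ...   | inj₂ hits = ⊥-elim (ℕ.<⇒≱ small (ℕ.≤-trans enough (hitting-bound S (routes u v) disjoint hits)))

commonNeighbours : (G : Graph) → Vertex G → Vertex G → List (List (Vertex G))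
commonNeighbours G u v = map (_∷ []) (filter (λ w → edge? G u w ×-dec edge? G w v) (allFin (size G)))

IsTriangle : (G : Graph) → Vertex G → Vertex G → Vertex G → Set
IsTriangle G x y z = Edge G x y × Edge G y z × Edge G x z

IsClaw : (G : Graph) → Vertex G → Vertex G → Vertex G → Vertex G → Set
IsClaw G c x y z =
  (Edge G c x × Edge G c y × Edge G c z) ×
  (adj G x y ≡ false × adj G x z ≡ false × adj G y z ≡ false) × (x ≢ y × x ≢ z × y ≢ z)

IsC4 : (G : Graph) → Vertex G → Vertex G → Vertex G → Vertex G → Set
IsC4 G p q r t =
  (Edge G p q × Edge G q r × Edge G r t × Edge G t p) ×
  (adj G p r ≡ false × adj G q t ≡ false) × (p ≢ r × q ≢ t)

HasTriangle HasClaw HasC4 : Graph → Set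
HasTriangle G = ∃[ x ] ∃[ y ] ∃[ z ] IsTriangle G x y z
HasClaw G = ∃[ c ] ∃[ x ] ∃[ y ] ∃[ z ] IsClaw G c x y z
HasC4 G = ∃[ p ] ∃[ q ] ∃[ r ] ∃[ t ] IsC4 G p q r t

isClaw? : ∀ G c x y z → Dec (IsClaw G c x y z)
isClaw? G c x y z =
  (edge? G c x ×-dec edge? G c y ×-dec edge? G c z) ×-dec
  (non-edge? G x y ×-dec non-edge? G x z ×-dec non-edge? G y z) ×-dec
  (distinct? x y ×-dec distinct? x z ×-dec distinct? y z)

isC4? : ∀ G p q r t → Dec (IsC4 G p q r t)
isC4? G p q r t =
  (edge? G p q ×-dec edge? G q r ×-dec edge? G r t ×-dec edge? G t p) ×-dec
  (non-edge? G p r ×-dec non-edge? G q t) ×-dec (distinct? p r ×-dec distinct? q t)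

module _ (F G : Graph) (e : InducedSub F G) where
  open Embedding F G e

  triangle-transfer : HasTriangle F → HasTriangle G
  triangle-transfer (x , y , z , xy , yz , xz) = f x , f y , f z , edge xy , edge yz , edge xz

  claw-transfer : HasClaw F → HasClaw G
  claw-transfer (c , x , y , z , (cx , cy , cz) , (xy , xz , yz) , (x≢y , x≢z , y≢z)) =
    f c , f x , f y , f z , (edge cx , edge cy , edge cz) , (non-edge xy , non-edge xz , non-edge yz) ,
    (distinct x≢y , distinct x≢z , distinct y≢z)

  C4-transfer : HasC4 F → HasC4 G
  C4-transfer (p , q , r , t , (pq , qr , rt , tp) , (pr , qt) , (p≢r , q≢t)) =
    f p , f q , f r , f t , (edge pq , edge qr , edge rt , edge tp) , (non-edge pr , non-edge qt) ,
    (distinct p≢r , distinct q≢t)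

same-or-flipped : ∀ b c → c ≡ b ⊎ c ≡ not b
same-or-flipped true  true  = inj₁ refl
same-or-flipped true  false = inj₂ refl
same-or-flipped false true  = inj₂ refl
same-or-flipped false false = inj₁ refl

module CompleteBipartite (F : Graph) (side : Vertex F → Bool)
                         (law : ∀ u v → adj F u v ≡ side u xor side v) where

  across : ∀ {u v b} → side u ≡ b → side v ≡ not b → Edge F u v
  across {u} {v} {b} su sv = trans (law u v) (trans (cong₂ _xor_ su sv) (Bool.xor-inverseʳ b))

  across˘ : ∀ {u v b} → side u ≡ not b → side v ≡ b → Edge F u v
  across˘ {u} {v} su sv = trans (adj-sym F u v) (across sv su)

  within : ∀ {u v b} → side u ≡ b → side v ≡ b → adj F u v ≡ false
  within {u} {v} {b} su sv = trans (law u v) (trans (cong₂ _xor_ su sv) (Bool.xor-same b))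

  neighbour-side : ∀ {u w} → Edge F u w → side w ≡ not (side u)
  neighbour-side {u} {w} uw = flip (side u) (side w) (trans (sym (law u w)) uw)
    where
    flip : ∀ a b → a xor b ≡ true → b ≡ not a
    flip true  false _ = refl
    flip false true  _ = refl

  -- three vertices cannot lie pairwise on different sides
  triangle-free : ¬ HasTriangle F
  triangle-free (x , y , z , xy , yz , xz) =
    odd (side x) (side y) (side z) (trans (sym (law x y)) xy) (trans (sym (law y z)) yz) (trans (sym (law x z)) xz)
    where
    odd : ∀ a b c → a xor b ≡ true → b xor c ≡ true → a xor c ≡ true → ⊥
    odd true  true  _     () _  _
    odd false false _     () _  _
    odd true  false true  _  _  ()
    odd true  false false _  () _
    odd false true  true  _  () _
    odd false true  false _  _  ()

  claw-at : ∀ {b c x y z} → side c ≡ not b → side x ≡ b → side y ≡ b → side z ≡ b →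
    x ≢ y → x ≢ z → y ≢ z → HasClaw F
  claw-at sc sx sy sz x≢y x≢z y≢z =
    _ , _ , _ , _ , (across˘ sc sx , across˘ sc sy , across˘ sc sz) ,
    (within sx sy , within sx sz , within sy sz) , (x≢y , x≢z , y≢z)

  C4-at : ∀ {b p q r t} → side p ≡ b → side q ≡ not b → side r ≡ b → side t ≡ not b →
    p ≢ r → q ≢ t → HasC4 F
  C4-at sp sq sr st p≢r q≢t =
    _ , _ , _ , _ , (across sp sq , across˘ sq sr , across sr st , across˘ st sp) ,
    (within sp sr , within sq st) , (p≢r , q≢t)

  -- Four distinct vertices x₀ … x₃ and a neighbour w of x₀ contain an induced claw or C4:
  -- if all x's lie on one side, w is the centre of a claw; a 3+1 split gives a claw
  -- centred at the lonely vertex, and a 2+2 split gives a C4.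
  module _ (x : Fin 4 ↣ Vertex F) where
    private
      x₀ x₁ x₂ x₃ : Vertex F
      x₀ = Injection.to x (# 0)
      x₁ = Injection.to x (# 1)
      x₂ = Injection.to x (# 2)
      x₃ = Injection.to x (# 3)

      distinct : ∀ {i j} → i ≢ j → Injection.to x i ≢ Injection.to x j
      distinct i≢j = i≢j ∘ Injection.injective x

    claw-or-C4 : ∀ {w} → Edge F x₀ w → HasClaw F ⊎ HasC4 F
    claw-or-C4 x₀w
      with same-or-flipped (side x₀) (side x₁) | same-or-flipped (side x₀) (side x₂)
         | same-or-flipped (side x₀) (side x₃)
    ... | inj₁ s₁ | inj₁ s₂ | inj₁ s₃ =
      inj₁ (claw-at (neighbour-side x₀w) refl s₁ s₂ (distinct λ ()) (distinct λ ()) (distinct λ ()))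
    ... | inj₁ s₁ | inj₁ s₂ | inj₂ f₃ = inj₁ (claw-at f₃ refl s₁ s₂ (distinct λ ()) (distinct λ ()) (distinct λ ()))
    ... | inj₁ s₁ | inj₂ f₂ | inj₁ s₃ = inj₁ (claw-at f₂ refl s₁ s₃ (distinct λ ()) (distinct λ ()) (distinct λ ()))
    ... | inj₂ f₁ | inj₁ s₂ | inj₁ s₃ = inj₁ (claw-at f₁ refl s₂ s₃ (distinct λ ()) (distinct λ ()) (distinct λ ()))
    ... | inj₂ f₁ | inj₂ f₂ | inj₂ f₃ =
      inj₁ (claw-at (sym (Bool.not-involutive (side x₀))) f₁ f₂ f₃ (distinct λ ()) (distinct λ ()) (distinct λ ()))
    ... | inj₁ s₁ | inj₂ f₂ | inj₂ f₃ = inj₂ (C4-at refl f₂ s₁ f₃ (distinct λ ()) (distinct λ ()))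
    ... | inj₂ f₁ | inj₁ s₂ | inj₂ f₃ = inj₂ (C4-at refl f₁ s₂ f₃ (distinct λ ()) (distinct λ ()))
    ... | inj₂ f₁ | inj₂ f₂ | inj₁ s₃ = inj₂ (C4-at refl f₁ s₃ f₂ (distinct λ ()) (distinct λ ()))

Near : ∀ {n} → Fin n → Fin n → Set
Near i j = (CycAfter 1 i j ⊎ CycAfter 2 i j) ⊎ (CycAfter 1 j i ⊎ CycAfter 2 j i)

Apart : ∀ {n} → Fin n → Fin n → Set
Apart i j = i ≢ j × ¬ Near i j

cycAfter? : ∀ {n} k (i j : Fin n) → Dec (CycAfter k i j)
cycAfter? {n} k i j = toℕ j ℕ.≟ toℕ i + k ⊎-dec toℕ j + n ℕ.≟ toℕ i + k

apart? : ∀ {n} (i j : Fin n) → Dec (Apart i j)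
apart? i j = distinct? i j ×-dec
  ¬? ((cycAfter? 1 i j ⊎-dec cycAfter? 2 i j) ⊎-dec (cycAfter? 1 j i ⊎-dec cycAfter? 2 j i))

module Square (G : Graph) (H : HasH² G) where
  σ : Vertex G ↔ Vertex G
  σ = proj₁ (proj₂ H)

  position : Vertex G → Vertex G
  position = Inverse.from σ

  near⇒adjacent : ∀ i j → Near i j → Edge G (Inverse.to σ i) (Inverse.to σ j)
  near⇒adjacent i j (inj₁ forward)  = proj₂ (proj₂ H) i j forward
  near⇒adjacent i j (inj₂ backward) = trans (adj-sym G _ _) (proj₂ (proj₂ H) j i backward)

  nonadjacent⇒apart : ∀ {x y} → x ≢ y → adj G x y ≡ false → Apart (position x) (position y)
  nonadjacent⇒apart {x} {y} x≢y ¬xy = distinct-positions , not-near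
    where
    at : ∀ v → Inverse.to σ (position v) ≡ v
    at = Inverse.strictlyInverseˡ σ

    distinct-positions : position x ≢ position y
    distinct-positions eq = x≢y (trans (sym (at x)) (trans (cong (Inverse.to σ) eq) (at y)))

    not-near : ¬ Near (position x) (position y)
    not-near near with trans (sym (near⇒adjacent _ _ near)) (trans (cong₂ (adj G) (at x) (at y)) ¬xy)
    ... | ()

H²⇒triangle : ∀ G → HasH² G → HasTriangle G
H²⇒triangle record { size = suc (suc (suc _)) } (_ , σ , square) =
  to f0 , to (fs f0) , to (fs (fs f0)) ,
  square _ _ (inj₁ (inj₁ refl)) , square _ _ (inj₁ (inj₁ refl)) , square _ _ (inj₂ (inj₁ refl))
  where to = Inverse.to σ
H²⇒triangle record { size = 0 } (()            , _)
H²⇒triangle record { size = 1 } (s≤s ()        , _)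
H²⇒triangle record { size = 2 } (s≤s (s≤s ()) , _)

-- On the 7-cycle, "apart" means "exactly three steps away", so the apart relation is
-- itself a 7-cycle; having odd girth 7, it has no closed walks of length 3 or 5.
no-apart-triangle : ∀ (a b : Fin 7) → Apart a b → ∀ c → Apart b c → ¬ Apart c a
no-apart-triangle = toWitness {a? = all? λ a → all? λ b → apart? a b →-dec all? λ c →
  apart? b c →-dec ¬? (apart? c a)} _

no-apart-pentagon : ∀ (a b : Fin 7) → Apart a b → ∀ c → Apart b c → ∀ d → Apart c d →
  ∀ e → Apart d e → ¬ Apart e a
no-apart-pentagon = toWitness {a? = all? λ a → all? λ b → apart? a b →-dec all? λ c →
  apart? b c →-dec all? λ d → apart? c d →-dec all? λ e → apart? d e →-dec ¬? (apart? e a)} _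

tableGraph : (n : ℕ) (a : Fin n → Fin n → Bool) →
  {True (all? λ u → all? λ v → a u v Bool.≟ a v u)} → {True (all? λ v → a v v Bool.≟ false)} → Graph
tableGraph n a {symmetric} {loopless} =
  record { size = n ; adj = a ; adj-sym = toWitness symmetric ; adj-irrefl = toWitness loopless }

-- Routes u – x – y – v through a neighbour x of u that is not adjacent to v and a
-- neighbour y of v that is not adjacent to u.
detours : (G : Graph) → Vertex G → Vertex G → List (List (Vertex G))
detours G u v = concatMap (λ x → map (λ y → x ∷ y ∷ []) (filter (λ y → edge? G x y) (privateNeighbours v u)))
                          (privateNeighbours u v)
  where
  privateNeighbours : Vertex G → Vertex G → List (Vertex G)
  privateNeighbours a b = filter (λ x → edge? G a x ×-dec non-edge? G x b) (allFin (size G))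

side₄₄ : Fin 8 → Bool
side₄₄ u = toℕ u <ᵇ 4

K₄₄ : Graph
K₄₄ = record
  { size = 8
  ; adj = λ u v → side₄₄ u xor side₄₄ v
  ; adj-sym = λ u v → Bool.xor-comm (side₄₄ u) (side₄₄ v)
  ; adj-irrefl = λ v → Bool.xor-same (side₄₄ v)
  }

K₄₄-4-connected : KConnected 4 K₄₄
K₄₄-4-connected = certificate⇒connected 4 K₄₄ (commonNeighbours K₄₄) (s≤s (s≤s (s≤s (s≤s (s≤s z≤n)))))
  (toWitness {a? = certificate? 4 K₄₄ (commonNeighbours K₄₄)} _)

K₄₄-triangle-free : ¬ HasTriangle K₄₄
K₄₄-triangle-free = CompleteBipartite.triangle-free K₄₄ side₄₄ (λ _ _ → refl)

K₄₄-no-H² : ¬ HasH² K₄₄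
K₄₄-no-H² = K₄₄-triangle-free ∘ H²⇒triangle K₄₄

-- G₂ = C₅ ∨ 2K₁: the 5-cycle 0-1-2-3-4 joined to the nonadjacent vertices 5 and 6.
-- Its non-edges are the pentagon 0-2-4-1-3-0 and the pair 5-6.
missing₂ : ℕ → ℕ → Bool
missing₂ 0 2 = true
missing₂ 2 4 = true
missing₂ 4 1 = true
missing₂ 1 3 = true
missing₂ 3 0 = true
missing₂ 5 6 = true
missing₂ _ _ = false

G₂ : Graph
G₂ = tableGraph 7 λ u v → not ⌊ u ≟ v ⌋ ∧ not (missing₂ (toℕ u) (toℕ v) ∨ missing₂ (toℕ v) (toℕ u))

G₂-4-connected : KConnected 4 G₂
G₂-4-connected = certificate⇒connected 4 G₂ routes (s≤s (s≤s (s≤s (s≤s (s≤s z≤n)))))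
  (toWitness {a? = certificate? 4 G₂ routes} _)
  where
  routes : Vertex G₂ → Vertex G₂ → List (List (Vertex G₂))
  routes u v = commonNeighbours G₂ u v ++ detours G₂ u v

G₂-claw-free : ¬ HasClaw G₂
G₂-claw-free (c , x , y , z , claw) =
  toWitness {a? = all? λ c → all? λ x → all? λ y → all? λ z → ¬? (isClaw? G₂ c x y z)} _ c x y z claw

-- The non-edge pentagon would need five positions on the 7-cycle, consecutive ones apart.
G₂-no-H² : ¬ HasH² G₂
G₂-no-H² H = no-apart-pentagon _ _ (apart (# 0) (# 2)) _ (apart (# 2) (# 4)) _ (apart (# 4) (# 1))
                                _ (apart (# 1) (# 3)) (apart (# 3) (# 0))
  where
  open Square G₂ H
  apart : ∀ x y → {True (distinct? x y ×-dec non-edge? G₂ x y)} → Apart (position x) (position y)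
  apart x y {ok} = let x≢y , ¬xy = toWitness ok in nonadjacent⇒apart x≢y ¬xy

G₃ : Graph
G₃ = tableGraph 7 λ u v → not ⌊ u ≟ v ⌋ ∧ not ((4 ≤ᵇ toℕ u) ∧ (4 ≤ᵇ toℕ v))

G₃-4-connected : KConnected 4 G₃
G₃-4-connected = certificate⇒connected 4 G₃ (commonNeighbours G₃) (s≤s (s≤s (s≤s (s≤s (s≤s z≤n)))))
  (toWitness {a? = certificate? 4 G₃ (commonNeighbours G₃)} _)

G₃-C4-free : ¬ HasC4 G₃
G₃-C4-free (p , q , r , t , c4) =
  toWitness {a? = all? λ p → all? λ q → all? λ r → all? λ t → ¬? (isC4? G₃ p q r t)} _ p q r t c4

-- The independent triple 4, 5, 6 would need three pairwise apart positions on the 7-cycle.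
G₃-no-H² : ¬ HasH² G₃
G₃-no-H² H = no-apart-triangle _ _ (apart (# 4) (# 5)) _ (apart (# 5) (# 6)) (apart (# 6) (# 4))
  where
  open Square G₃ H
  apart : ∀ x y → {True (distinct? x y ×-dec non-edge? G₃ x y)} → Apart (position x) (position y)
  apart x y {ok} = let x≢y , ¬xy = toWitness ok in nonadjacent⇒apart x≢y ¬xy

first-four : ∀ {n} → 4 ≤ n → Fin 4 ↣ Fin n
first-four le = mk↣ {to = λ i → inject≤ i le} (inject≤-injective le le _ _)

module Necessity (F : Graph) (hyp : ∀ G → KConnected 4 G → Free F G → HasH² G) where

  occurs-in : ∀ G → KConnected 4 G → ¬ HasH² G → ¬ Free F G
  occurs-in G connected no-H² F-free = no-H² (hyp G connected F-free)

  triangle-free : ¬ HasTriangle F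
  triangle-free t = occurs-in K₄₄ K₄₄-4-connected K₄₄-no-H² λ e → K₄₄-triangle-free (triangle-transfer F K₄₄ e t)

  claw-free : ¬ HasClaw F
  claw-free claw = occurs-in G₂ G₂-4-connected G₂-no-H² λ e → G₂-claw-free (claw-transfer F G₂ e claw)

  C4-free : ¬ HasC4 F
  C4-free c4 = occurs-in G₃ G₃-4-connected G₃-no-H² λ e → G₃-C4-free (C4-transfer F G₃ e c4)

  -- Being an induced subgraph of K₄,₄, a connected F with four vertices would be complete
  -- bipartite and so contain a claw or a C4.
  at-most-three : Connected F → ¬ (4 ≤ size F)
  at-most-three connected big = occurs-in K₄₄ K₄₄-4-connected K₄₄-no-H² λ e →
    let open Embedding F K₄₄ e
        open CompleteBipartite F (side₄₄ ∘ f) (λ u v → sym (proj₂ e u v))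
        x = first-four big
        w , x₀w = neighbour connected {Injection.to x (# 0)} {Injection.to x (# 1)} λ eq → case Injection.injective x eq of λ ()
    in [ claw-free , C4-free ] (claw-or-C4 x x₀w)

table : Bool → Bool → Bool → Fin 3 → Fin 3 → Bool
table b₀₁ b₀₂ b₁₂ f0           (fs f0)      = b₀₁
table b₀₁ b₀₂ b₁₂ (fs f0)      f0           = b₀₁
table b₀₁ b₀₂ b₁₂ f0           (fs (fs f0)) = b₀₂
table b₀₁ b₀₂ b₁₂ (fs (fs f0)) f0           = b₀₂
table b₀₁ b₀₂ b₁₂ (fs f0)      (fs (fs f0)) = b₁₂
table b₀₁ b₀₂ b₁₂ (fs (fs f0)) (fs f0)      = b₁₂
table b₀₁ b₀₂ b₁₂ _            _            = false

module ThreeVertices (a : Fin 3 → Fin 3 → Bool)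
                     (a-sym : ∀ u v → a u v ≡ a v u) (a-irr : ∀ v → a v v ≡ false) where
  F₃ : Graph
  F₃ = record { size = 3 ; adj = a ; adj-sym = a-sym ; adj-irrefl = a-irr }

  determined : ∀ {b₀₁ b₀₂ b₁₂} → a (# 0) (# 1) ≡ b₀₁ → a (# 0) (# 2) ≡ b₀₂ → a (# 1) (# 2) ≡ b₁₂ →
    ∀ u v → a u v ≡ table b₀₁ b₀₂ b₁₂ u v
  determined e₀₁ e₀₂ e₁₂ f0           f0           = a-irr _
  determined e₀₁ e₀₂ e₁₂ (fs f0)      (fs f0)      = a-irr _
  determined e₀₁ e₀₂ e₁₂ (fs (fs f0)) (fs (fs f0)) = a-irr _
  determined e₀₁ e₀₂ e₁₂ f0           (fs f0)      = e₀₁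
  determined e₀₁ e₀₂ e₁₂ f0           (fs (fs f0)) = e₀₂
  determined e₀₁ e₀₂ e₁₂ (fs f0)      (fs (fs f0)) = e₁₂
  determined e₀₁ e₀₂ e₁₂ (fs f0)      f0           = trans (a-sym _ _) e₀₁
  determined e₀₁ e₀₂ e₁₂ (fs (fs f0)) f0           = trans (a-sym _ _) e₀₂
  determined e₀₁ e₀₂ e₁₂ (fs (fs f0)) (fs f0)      = trans (a-sym _ _) e₁₂

  -- If the two edges meet at c, the transposition of c and 1 is an isomorphism onto P₃.
  centred-path : ∀ {b₀₁ b₀₂ b₁₂} (c : Fin 3) → (∀ u v → a u v ≡ table b₀₁ b₀₂ b₁₂ u v) →
    {True (all? λ u → all? λ v →
             p3adj (Inverse.to (transpose c (# 1)) u) (Inverse.to (transpose c (# 1)) v) Bool.≟ table b₀₁ b₀₂ b₁₂ u v)} →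
    F₃ ≅ P₃
  centred-path c a≡table {matches} = transpose c (# 1) , λ u v → trans (toWitness matches u v) (sym (a≡table u v))

  isolated : ∀ {b₀₁ b₀₂ b₁₂} (v o : Fin 3) → v ≢ o → (∀ u w → a u w ≡ table b₀₁ b₀₂ b₁₂ u w) →
    {True (all? λ w → table b₀₁ b₀₂ b₁₂ v w Bool.≟ false)} → ¬ Connected F₃
  isolated v o v≢o a≡table {empty-row} connected with neighbour {F₃} connected v≢o
  ... | w , vw with trans (sym vw) (trans (a≡table v w) (toWitness empty-row w))
  ... | ()

  -- A connected triangle-free graph on three vertices has exactly two edges, so it is P₃.
  connected-triangle-free⇒P₃ : Connected F₃ → ¬ HasTriangle F₃ → F₃ ≅ P₃
  connected-triangle-free⇒P₃ connected triangle-free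
    with a (# 0) (# 1) in e₀₁ | a (# 0) (# 2) in e₀₂ | a (# 1) (# 2) in e₁₂
  ... | true  | true  | true  = ⊥-elim (triangle-free (# 0 , # 1 , # 2 , e₀₁ , e₁₂ , e₀₂))
  ... | true  | true  | false = centred-path (# 0) (determined e₀₁ e₀₂ e₁₂)
  ... | true  | false | true  = centred-path (# 1) (determined e₀₁ e₀₂ e₁₂)
  ... | false | true  | true  = centred-path (# 2) (determined e₀₁ e₀₂ e₁₂)
  ... | true  | false | false = ⊥-elim (isolated (# 2) (# 0) (λ ()) (determined e₀₁ e₀₂ e₁₂) connected)
  ... | false | true  | false = ⊥-elim (isolated (# 1) (# 0) (λ ()) (determined e₀₁ e₀₂ e₁₂) connected)
  ... | false | false | _     = ⊥-elim (isolated (# 0) (# 1) (λ ()) (determined e₀₁ e₀₂ e₁₂) connected)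

necessity : ∀ F → Connected F → 3 ≤ size F → (∀ G → KConnected 4 G → Free F G → HasH² G) → F ≅ P₃
necessity F@record { size = 3 ; adj = a ; adj-sym = a-sym ; adj-irrefl = a-irr } connected _ hyp =
  ThreeVertices.connected-triangle-free⇒P₃ a a-sym a-irr connected (Necessity.triangle-free F hyp)
necessity F@record { size = suc (suc (suc (suc _))) } connected _ hyp =
  ⊥-elim (Necessity.at-most-three F hyp connected (s≤s (s≤s (s≤s (s≤s z≤n)))))
necessity record { size = 0 } _ ()             _
necessity record { size = 1 } _ (s≤s ())       _
necessity record { size = 2 } _ (s≤s (s≤s ())) _

proposition1 : (F : Graph) → Connected F → 3 ≤ size F →
    ((∀ (G : Graph) → KConnected 4 G → Free F G → HasH² G) ⇔ (F ≅ P₃))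
proposition1 F connected big = mk⇔ (necessity F connected big) (λ F≅P₃ → P₃-sufficient F F≅P₃)
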